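{- Let $n\ge1$. Let $T_n$ be the set of proper $2$-covers of $[n]$ and ${\cal S}_n$ the set of set partitions of $[2n]$. For $\tilde S\subseteq[2n]$ let $\psi(\tilde S)=\{j\in[n]: j\in\tilde S\text{ or } j+n\in\tilde S\}$. Let $E_{1,n}\subseteq{\cal S}_n$ be the set of partitions in which $j$ and $j+n$ lie in different blocks for every $j\in[n]$; let $E_{2,n}\subseteq{\cal S}_n$ be the set of partitions with blocks $\tilde S_1,\dots,\tilde S_m$ such that $\psi(\tilde S_{i_1})\ne\psi(\tilde S_{i_2})$ for all $i_1\ne i_2$; and let $C_n=E_{1,n}\cap E_{2,n}$. Define $\phi$ on ${\cal S}_n$ by $\phi(\{\tilde S_1,\dots,\tilde S_m\})=\{\psi(\tilde S_1),\dots,\psi(\tilde S_m)\}$ (as a multiset). Then $\phi$ maps $C_n$ onto $T_n$, and for every ${\bf a}\in T_n$ the number of $\omega\in C_n$ with $\phi(\omega)={\bf a}$ equals $2^n$.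
   Context: A $2$-cover of $[n]$ is a finite multiset $\{S_1,\dots,S_m\}$ of nonempty subsets of $[n]$ (repetitions allowed) such that every $d\in[n]$ lies in $S_j$ for exactly two indices $j$; it is proper if $S_i\ne S_j$ for all $i\ne j$. -}

module Defs where

open import Data.Nat using (ℕ; _+_)
open import Data.Bool using (_∨_)
open import Data.Fin using (Fin; _↑ˡ_; _↑ʳ_)
open import Data.Fin.Subset using (Subset; _∈_; Nonempty)
open import Data.Fin.Subset.Properties using (_∈?_)
open import Data.Vec using (tabulate; lookup)
open import Data.List using (List; map; filter; length)
open import Data.List.Relation.Unary.All using (All)
open import Data.List.Relation.Unary.Any using (Any)
open import Data.List.Relation.Unary.AllPairs using (AllPairs)
open import Data.List.Relation.Unary.Unique.Propositional using (Unique)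
open import Data.Product using (_×_)
open import Relation.Nullary using (¬_)
open import Relation.Binary.PropositionalEquality using (_≡_)

-- [n] is modelled by Fin n; subsets of [n] by Data.Fin.Subset.
-- A finite multiset of subsets is a List, considered up to permutation (_↭_).

multiplicity : ∀ {n} → Fin n → List (Subset n) → ℕ
multiplicity d a = length (filter (d ∈?_) a)

ProperTwoCover : (n : ℕ) → List (Subset n) → Set
ProperTwoCover n a =
  All Nonempty a × Unique a × (∀ (d : Fin n) → multiplicity d a ≡ 2)

Disjoint : ∀ {m} → Subset m → Subset m → Set
Disjoint A B = ∀ x → x ∈ A → x ∈ B → ⊥'
  where open import Data.Empty renaming (⊥ to ⊥')

IsPartition : (m : ℕ) → List (Subset m) → Set
IsPartition m ω =
  All Nonempty ω × AllPairs Disjoint ω × (∀ (x : Fin m) → Any (x ∈_) ω)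

-- [2n] is Fin (n + n); element j of [n] is j ↑ˡ n, and j+n is (n ↑ʳ j)
ψ : (n : ℕ) → Subset (n + n) → Subset n
ψ n S = tabulate (λ j → lookup S ((j ↑ˡ n)) ∨ lookup S ((n ↑ʳ j)))

E₁ : (n : ℕ) → List (Subset (n + n)) → Set
E₁ n ω = ∀ (j : Fin n) → All (λ B → ¬ ((j ↑ˡ n) ∈ B × (n ↑ʳ j) ∈ B)) ω

φ : (n : ℕ) → List (Subset (n + n)) → List (Subset n)
φ n ω = map (ψ n) ω

E₂ : (n : ℕ) → List (Subset (n + n)) → Set
E₂ n ω = Unique (φ n ω)

C : (n : ℕ) → List (Subset (n + n)) → Set
C n ω = IsPartition (n + n) ω × E₁ n ω × E₂ n ω

-- Let ω ∈ C_n and j ∈ [n]. Exactly two blocks of ω have ψ-images containing j, and by E₁ one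
-- of them contains j and the other j + n. Recording the membership of a fixed point in each block
-- as a Boolean column, the column of j in ω is thus the column of j in the cover φ(ω) with its two
-- trues replaced by b, not b, and the column of j + n the same with not b, b, for a bit b
-- depending on j. So ω is determined by its image and n bits, and conversely every choice of n
-- bits lifts a proper 2-cover to a partition in C_n over it. Distinct bits give lifts that are not
-- permutations of each other, since a permutation preserving the pairwise distinct ψ-images of
-- the blocks must be the identity.
module Submission where

open import Defs
open import Data.Nat using (ℕ; _≤_; _^_; _+_)
open import Data.List using (List; length)
open import Data.Fin.Subset using (Subset)
open import Data.List.Relation.Unary.All using (All)
open import Data.List.Relation.Unary.Any using (Any)
open import Data.List.Relation.Unary.AllPairs using (AllPairs)
open import Data.List.Relation.Binary.Permutation.Propositional using (_↭_)
open import Data.Product using (_×_; ∃)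
open import Relation.Nullary using (¬_)
open import Relation.Binary.PropositionalEquality using (_≡_)

open import Function using (_∘_)
open import Data.Nat using (zero; suc; _<_; z≤n; s≤s⁻¹; z<s; ⌊_/2⌋; ⌈_/2⌉)
open import Data.Nat.Properties
  using (≤-refl; ≤-trans; ≤-reflexive; n≤1+n; <⇒≱; +-suc; +-identityʳ; suc-injective)
open import Data.Bool using (Bool; true; false; not; _∧_; _∨_; _xor_)
open import Data.Bool.Properties using (∨-zeroʳ)
open import Data.Empty using (⊥-elim)
open import Data.Fin using (Fin; _↑ˡ_; _↑ʳ_; splitAt)
open import Data.Fin.Properties using (splitAt⁻¹-↑ˡ; splitAt⁻¹-↑ʳ)
open import Data.Fin.Subset using (_∈_; Nonempty; _∩_; ∁; inside; outside) renaming (⊥ to ∅)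
open import Data.Fin.Subset.Properties using (_∈?_)
open import Data.Vec using (Vec; []; _∷_; lookup; tabulate; zipWith; _++_)
open import Data.Vec.Properties
  using (lookup-++ˡ; lookup-++ʳ; lookup-zipWith; lookup-map; lookup∘tabulate; tabulate∘lookup;
         tabulate-cong; []=⇒lookup; lookup⇒[]=)
  renaming (∷-injectiveʳ to Vec-∷-injectiveʳ)
open import Data.Vec.Relation.Binary.Pointwise.Extensional using (ext; Pointwise-≡⇒≡)
open import Data.List using ([]; _∷_; [_]; map) renaming (_++_ to _++ₗ_)
open import Data.List.Properties
  using (∷-injectiveˡ; ∷-injectiveʳ; length-map; length-++; map-∘; map-cong)
open import Data.List.Membership.Propositional using () renaming (_∈_ to _∈ₗ_)
open import Data.List.Membership.Propositional.Properties
  using (∈-map⁺; ∈-map⁻; ∈-++⁺ˡ; ∈-++⁺ʳ)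
open import Data.List.Relation.Binary.Disjoint.Propositional
  using () renaming (Disjoint to DisjointLists)
open import Data.List.Relation.Binary.Permutation.Propositional
  using (prep; swap; ↭-reflexive; ↭-trans)
import Data.List.Relation.Binary.Permutation.Propositional as ↭
open import Data.List.Relation.Binary.Permutation.Propositional.Properties
  using (All-resp-↭; ↭-map-inv; drop-∷; ∈-resp-↭) renaming (map⁺ to ↭-map⁺)
import Data.List.Relation.Unary.All as All
import Data.List.Relation.Unary.All.Properties as All
import Data.List.Relation.Unary.Any as Any
import Data.List.Relation.Unary.Any.Properties as Any
open import Data.List.Relation.Unary.Any using (here; there)
import Data.List.Relation.Unary.AllPairs as AllPairs
import Data.List.Relation.Unary.AllPairs.Properties as AllPairs
open import Data.List.Relation.Unary.Unique.Propositional using (Unique)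
import Data.List.Relation.Unary.Unique.Propositional.Properties as Unique
import Data.Product as Product
open import Data.Product using (_,_; proj₁; proj₂)
open import Data.Sum using (inj₁; inj₂)
open import Relation.Nullary using (yes; no)
open import Relation.Binary.PropositionalEquality
  using (refl; sym; trans; cong; cong₂; subst; module ≡-Reasoning)

∧-∨-∧-not : ∀ x y → (x ∧ y) ∨ (x ∧ not y) ≡ x
∧-∨-∧-not true  true  = refl
∧-∨-∧-not true  false = refl
∧-∨-∧-not false _     = refl

∧-not-exclusive : ∀ x y → ¬ (x ∧ y ≡ true × x ∧ not y ≡ true)
∧-not-exclusive true  true  (_  , ())
∧-not-exclusive true  false (() , _)
∧-not-exclusive false _     (() , _)

trues : List Bool → ℕ
trues []           = 0
trues (true  ∷ bs) = suc (trues bs)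
trues (false ∷ bs) = trues bs

trues-∷-≤ : ∀ b bs → trues bs ≤ trues (b ∷ bs)
trues-∷-≤ true  bs = n≤1+n (trues bs)
trues-∷-≤ false bs = ≤-refl

trues-↭ : ∀ {bs bs′} → bs ↭ bs′ → trues bs ≡ trues bs′
trues-↭ ↭.refl               = refl
trues-↭ (prep true p)        = cong suc (trues-↭ p)
trues-↭ (prep false p)       = trues-↭ p
trues-↭ (swap true true p)   = cong (suc ∘ suc) (trues-↭ p)
trues-↭ (swap true false p)  = cong suc (trues-↭ p)
trues-↭ (swap false true p)  = cong suc (trues-↭ p)
trues-↭ (swap false false p) = trues-↭ p
trues-↭ (↭.trans p q)        = trans (trues-↭ p) (trues-↭ q)

column : ∀ {A : Set} {m} → Fin m → List (Vec A m) → List A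
column x = map (λ v → lookup v x)

columns-injective : ∀ {A : Set} {m} (ω ω′ : List (Vec A m)) → length ω ≡ length ω′ →
                    (∀ x → column x ω ≡ column x ω′) → ω ≡ ω′
columns-injective []      []        _   _    = refl
columns-injective (v ∷ ω) (v′ ∷ ω′) len cols =
  cong₂ _∷_ (Pointwise-≡⇒≡ (ext (λ x → ∷-injectiveˡ (cols x))))
            (columns-injective ω ω′ (suc-injective len) (λ x → ∷-injectiveʳ (cols x)))

trues-column-↭ : ∀ {m} (x : Fin m) {ω ω′ : List (Vec Bool m)} → ω ↭ ω′ →
                 trues (column x ω) ≡ trues (column x ω′)
trues-column-↭ x ω↭ω′ = trues-↭ (↭-map⁺ (λ v → lookup v x) ω↭ω′)

multiplicity≡trues-column : ∀ {n} (d : Fin n) a → multiplicity d a ≡ trues (column d a)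
multiplicity≡trues-column d []      = refl
multiplicity≡trues-column d (S ∷ a) with d ∈? S
... | yes d∈S rewrite []=⇒lookup d∈S = cong suc (multiplicity≡trues-column d a)
... | no d∉S with lookup S d in eq
...   | true  = ⊥-elim (d∉S (lookup⇒[]= d S eq))
...   | false = multiplicity≡trues-column d a

trues-column-twice : ∀ {n} (a : List (Subset n)) → (∀ d → multiplicity d a ≡ 2) →
                     ∀ j → trues (column j a) ≡ 2
trues-column-twice a twice j = trans (sym (multiplicity≡trues-column j a)) (twice j)

lookup≡false⇒∉ : ∀ {m} {p : Subset m} {x} → lookup p x ≡ false → ¬ x ∈ p
lookup≡false⇒∉ eq x∈p with () ← trans (sym eq) ([]=⇒lookup x∈p)

trues-column-disjoint : ∀ {m} (x : Fin m) {B} ω → All (Disjoint B) ω → x ∈ B →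
                        trues (column x ω) ≡ 0
trues-column-disjoint x []       All.[]              _   = refl
trues-column-disjoint x (B′ ∷ ω) (B#B′ All.∷ B#ω) x∈B with lookup B′ x in eq
... | true  = ⊥-elim (B#B′ x x∈B (lookup⇒[]= x B′ eq))
... | false = trues-column-disjoint x ω B#ω x∈B

trues-column-partition : ∀ {m} (x : Fin m) ω → AllPairs Disjoint ω → Any (x ∈_) ω →
                         trues (column x ω) ≡ 1
trues-column-partition x (B ∷ ω) (B#ω AllPairs.∷ disjoint) x∈ω with lookup B x in eq
... | true  = cong suc (trues-column-disjoint x ω B#ω (lookup⇒[]= x B eq))
... | false = trues-column-partition x ω disjoint (Any.tail (lookup≡false⇒∉ eq) x∈ω)

trues-column-∈ : ∀ {m} (x : Fin m) {B} ω → B ∈ₗ ω → x ∈ B → 0 < trues (column x ω)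
trues-column-∈ x (B ∷ ω) (here refl) x∈B rewrite []=⇒lookup x∈B = z<s
trues-column-∈ x (B ∷ ω) (there B′∈ω) x∈B′ with lookup B x
... | true  = z<s
... | false = trues-column-∈ x ω B′∈ω x∈B′

trues-column≤1⇒disjoint : ∀ {m} (ω : List (Subset m)) → (∀ x → trues (column x ω) ≤ 1) →
                          AllPairs Disjoint ω
trues-column≤1⇒disjoint []      _  = AllPairs.[]
trues-column≤1⇒disjoint (B ∷ ω) ≤1 =
  All.tabulate B#ω AllPairs.∷
  trues-column≤1⇒disjoint ω (λ x → ≤-trans (trues-∷-≤ (lookup B x) _) (≤1 x))
  where
  B#ω : ∀ {B′} → B′ ∈ₗ ω → Disjoint B B′
  B#ω B′∈ω x x∈B x∈B′ =
    <⇒≱ (trues-column-∈ x ω B′∈ω x∈B′)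
        (s≤s⁻¹ (subst (λ b → trues (b ∷ column x ω) ≤ 1) ([]=⇒lookup x∈B) (≤1 x)))

trues-column>0⇒covered : ∀ {m} (x : Fin m) ω → 0 < trues (column x ω) → Any (x ∈_) ω
trues-column>0⇒covered x (B ∷ ω) t>0 with lookup B x in eq
... | true  = here (lookup⇒[]= x B eq)
... | false = there (trues-column>0⇒covered x ω t>0)

trues-column≡1⇒IsPartition : ∀ {m} (ω : List (Subset m)) → All Nonempty ω →
                             (∀ x → trues (column x ω) ≡ 1) → IsPartition m ω
trues-column≡1⇒IsPartition ω nonempty once =
    nonempty
  , trues-column≤1⇒disjoint ω (λ x → ≤-reflexive (once x))
  , (λ x → trues-column>0⇒covered x ω (≤-reflexive (sym (once x))))

alternate : Bool → List Bool → List Bool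
alternate b []           = []
alternate b (false ∷ bs) = false ∷ alternate b bs
alternate b (true  ∷ bs) = b ∷ alternate (not b) bs

mutual
  trues-alternate-true : ∀ bs → trues (alternate true bs) ≡ ⌈ trues bs /2⌉
  trues-alternate-true []           = refl
  trues-alternate-true (false ∷ bs) = trues-alternate-true bs
  trues-alternate-true (true  ∷ bs) = cong suc (trues-alternate-false bs)

  trues-alternate-false : ∀ bs → trues (alternate false bs) ≡ ⌊ trues bs /2⌋
  trues-alternate-false []           = refl
  trues-alternate-false (false ∷ bs) = trues-alternate-false bs
  trues-alternate-false (true  ∷ bs) = trues-alternate-true bs

trues-alternate-pair : ∀ b bs → trues bs ≡ 2 → trues (alternate b bs) ≡ 1
trues-alternate-pair true  bs two = trans (trues-alternate-true bs) (cong ⌈_/2⌉ two)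
trues-alternate-pair false bs two = trans (trues-alternate-false bs) (cong ⌊_/2⌋ two)

alternate-injective : ∀ {b b′} bs → 0 < trues bs → alternate b bs ≡ alternate b′ bs → b ≡ b′
alternate-injective (false ∷ bs) t>0 eq = alternate-injective bs t>0 (∷-injectiveʳ eq)
alternate-injective (true  ∷ bs) _   eq = ∷-injectiveˡ eq

module _ {A : Set} (l r : A → Bool) where

  l∨r : A → Bool
  l∨r B = l B ∨ r B

  Exclusive : A → Set
  Exclusive B = ¬ (l B ≡ true × r B ≡ true)

  trues-∨ : ∀ ω → All Exclusive ω →
            trues (map l∨r ω) ≡ trues (map l ω) + trues (map r ω)
  trues-∨ []      All.[]             = refl
  trues-∨ (B ∷ ω) (excl All.∷ excls) with l B | r B
  ... | true  | true  = ⊥-elim (excl (refl , refl))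
  ... | true  | false = cong suc (trues-∨ ω excls)
  ... | false | true  = trans (cong suc (trues-∨ ω excls)) (sym (+-suc _ _))
  ... | false | false = trues-∨ ω excls

  Alternating : Bool → List A → Set
  Alternating b ω = map l ω ≡ alternate b (map l∨r ω) × map r ω ≡ alternate (not b) (map l∨r ω)

  -- The bounds say that l and r have at most one true between them, in l if b and in r otherwise.
  alternating-from : ∀ b ω → trues (map l ω) ≤ trues [ b ] → trues (map r ω) ≤ trues [ not b ] →
                     Alternating b ω
  alternating-from b     []      _  _  = refl , refl
  alternating-from true  (B ∷ ω) ≤1 ≤0 with l B | r B
  ... | false | false = Product.map (cong (false ∷_)) (cong (false ∷_))
                          (alternating-from true ω ≤1 ≤0)
  ... | true  | false = Product.map (cong (true ∷_)) (cong (false ∷_))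
                          (alternating-from false ω (s≤s⁻¹ ≤1) (≤-trans ≤0 z≤n))
  ... | _     | true  with () ← ≤0
  alternating-from false (B ∷ ω) ≤0 ≤1 with l B | r B
  ... | false | false = Product.map (cong (false ∷_)) (cong (false ∷_))
                          (alternating-from false ω ≤0 ≤1)
  ... | false | true  = Product.map (cong (false ∷_)) (cong (true ∷_))
                          (alternating-from true ω (≤-trans ≤0 z≤n) (s≤s⁻¹ ≤1))
  ... | true  | _     with () ← ≤0

  alternating : ∀ ω → All Exclusive ω → trues (map l ω) ≡ 1 → trues (map r ω) ≡ 1 →
                ∃ λ b → Alternating b ω
  alternating (B ∷ ω) (excl All.∷ excls) once₁ once₂ with l B | r B
  ... | false | false = Product.map₂ (Product.map (cong (false ∷_)) (cong (false ∷_)))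
                          (alternating ω excls once₁ once₂)
  ... | true  | false = true , Product.map (cong (true ∷_)) (cong (false ∷_))
                          (alternating-from false ω (≤-reflexive (suc-injective once₁))
                                                    (≤-reflexive once₂))
  ... | false | true  = false , Product.map (cong (false ∷_)) (cong (true ∷_))
                          (alternating-from true ω (≤-reflexive once₁)
                                                   (≤-reflexive (suc-injective once₂)))
  ... | true  | true  = ⊥-elim (excl (refl , refl))

↭∧map≡⇒≡ : ∀ {A B : Set} (f : A → B) {xs ys : List A} →
           Unique (map f xs) → map f xs ≡ map f ys → xs ↭ ys → xs ≡ ys
↭∧map≡⇒≡ f {[]}     {[]}     _ _ _ = refl
↭∧map≡⇒≡ f {x ∷ xs} {y ∷ ys} (fx∉fxs AllPairs.∷ unique) eq xs↭ys
  with ∈-resp-↭ xs↭ys (here refl)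
... | here refl  = cong (x ∷_) (↭∧map≡⇒≡ f unique (∷-injectiveʳ eq) (drop-∷ xs↭ys))
... | there x∈ys =
  ⊥-elim (All.lookup fx∉fxs (subst (f x ∈ₗ_) (sym (∷-injectiveʳ eq)) (∈-map⁺ f x∈ys)) refl)

subsets : ∀ m → List (Subset m)
subsets zero    = [ [] ]
subsets (suc m) = map (inside ∷_) (subsets m) ++ₗ map (outside ∷_) (subsets m)

length-subsets : ∀ m → length (subsets m) ≡ 2 ^ m
length-subsets zero    = refl
length-subsets (suc m) = begin
  length (map (inside ∷_) (subsets m) ++ₗ map (outside ∷_) (subsets m))
    ≡⟨ length-++ (map (inside ∷_) (subsets m)) ⟩
  length (map (inside ∷_) (subsets m)) + length (map (outside ∷_) (subsets m))
    ≡⟨ cong₂ _+_ (length-map _ (subsets m)) (length-map _ (subsets m)) ⟩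
  length (subsets m) + length (subsets m)
    ≡⟨ cong₂ _+_ (length-subsets m) (length-subsets m) ⟩
  2 ^ m + 2 ^ m
    ≡⟨ cong (2 ^ m +_) (+-identityʳ (2 ^ m)) ⟨
  2 ^ suc m ∎
  where open ≡-Reasoning

∈-subsets : ∀ {m} (p : Subset m) → p ∈ₗ subsets m
∈-subsets []          = here refl
∈-subsets (true  ∷ p) = ∈-++⁺ˡ (∈-map⁺ (inside ∷_) (∈-subsets p))
∈-subsets (false ∷ p) = ∈-++⁺ʳ (map (inside ∷_) (subsets _)) (∈-map⁺ (outside ∷_) (∈-subsets p))

subsets-unique : ∀ m → Unique (subsets m)
subsets-unique zero    = All.[] AllPairs.∷ AllPairs.[]
subsets-unique (suc m) = Unique.++⁺ (Unique.map⁺ Vec-∷-injectiveʳ (subsets-unique m))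
                                    (Unique.map⁺ Vec-∷-injectiveʳ (subsets-unique m))
                                    heads-differ
  where
  heads-differ : DisjointLists (map (inside ∷_) (subsets m)) (map (outside ∷_) (subsets m))
  heads-differ (p , q) with ∈-map⁻ _ p | ∈-map⁻ _ q
  ... | _ , _ , refl | _ , _ , ()

↑ˡ-↑ʳ-elim : ∀ {m n} {P : Fin (m + n) → Set} →
             (∀ i → P (i ↑ˡ n)) → (∀ j → P (m ↑ʳ j)) → ∀ x → P x
↑ˡ-↑ʳ-elim {m} {n} {P} left right x with splitAt m x in eq
... | inj₁ i = subst P (splitAt⁻¹-↑ˡ eq) (left i)
... | inj₂ j = subst P (splitAt⁻¹-↑ʳ eq) (right j)

module _ {n : ℕ} where

  left right : Fin n → Subset (n + n) → Bool
  left  j B = lookup B (j ↑ˡ n)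
  right j B = lookup B (n ↑ʳ j)

  lookup-ψ : ∀ B j → lookup (ψ n B) j ≡ l∨r (left j) (right j) B
  lookup-ψ B j = lookup∘tabulate _ j

  column-φ : ∀ j ω → column j (φ n ω) ≡ map (l∨r (left j) (right j)) ω
  column-φ j ω = trans (sym (map-∘ ω)) (map-cong (λ B → lookup-ψ B j) ω)

  ψ-nonempty : ∀ {B} → Nonempty B → Nonempty (ψ n B)
  ψ-nonempty {B} (x , x∈B) =
    ↑ˡ-↑ʳ-elim {P = λ x → x ∈ B → Nonempty (ψ n B)} ∈left ∈right x x∈B
    where
    ∈left : ∀ j → j ↑ˡ n ∈ B → Nonempty (ψ n B)
    ∈left j p = j , lookup⇒[]= j (ψ n B)
                      (trans (lookup-ψ B j) (cong (_∨ right j B) ([]=⇒lookup p)))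
    ∈right : ∀ j → n ↑ʳ j ∈ B → Nonempty (ψ n B)
    ∈right j p = j , lookup⇒[]= j (ψ n B)
                       (trans (lookup-ψ B j)
                              (trans (cong (left j B ∨_) ([]=⇒lookup p)) (∨-zeroʳ (left j B))))

  E₁⇒exclusive : ∀ {ω} → E₁ n ω → ∀ j → All (Exclusive (left j) (right j)) ω
  E₁⇒exclusive e₁ j =
    All.map (λ ¬both (p , q) → ¬both (lookup⇒[]= _ _ p , lookup⇒[]= _ _ q)) (e₁ j)

  φ-C⇒ProperTwoCover : ∀ ω → C n ω → ProperTwoCover n (φ n ω)
  φ-C⇒ProperTwoCover ω ((nonempty , disjoint , covers) , e₁ , e₂) =
    All.map⁺ (All.map ψ-nonempty nonempty) , e₂ , twice
    where
    open ≡-Reasoning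
    once : ∀ x → trues (column x ω) ≡ 1
    once x = trues-column-partition x ω disjoint (covers x)
    twice : ∀ d → multiplicity d (φ n ω) ≡ 2
    twice d = begin
      multiplicity d (φ n ω)
        ≡⟨ multiplicity≡trues-column d (φ n ω) ⟩
      trues (column d (φ n ω))
        ≡⟨ cong trues (column-φ d ω) ⟩
      trues (map (l∨r (left d) (right d)) ω)
        ≡⟨ trues-∨ (left d) (right d) ω (E₁⇒exclusive e₁ d) ⟩
      trues (column (d ↑ˡ n) ω) + trues (column (n ↑ʳ d) ω)
        ≡⟨ cong₂ _+_ (once (d ↑ˡ n)) (once (n ↑ʳ d)) ⟩
      2 ∎

  block : Subset n → Subset n → Subset (n + n)
  block t S = (S ∩ t) ++ (S ∩ ∁ t)

  -- t j says which copy of j (j itself if t j, else j + n) goes to the next member of the cover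
  -- containing j; toggling t on S hands the other copy to the member after S.
  lift : Subset n → List (Subset n) → List (Subset (n + n))
  lift t []      = []
  lift t (S ∷ a) = block t S ∷ lift (zipWith _xor_ S t) a

  lookup-block-↑ˡ : ∀ t S j → lookup (block t S) (j ↑ˡ n) ≡ lookup S j ∧ lookup t j
  lookup-block-↑ˡ t S j = trans (lookup-++ˡ (S ∩ t) (S ∩ ∁ t) j) (lookup-zipWith _∧_ j S t)

  lookup-block-↑ʳ : ∀ t S j → lookup (block t S) (n ↑ʳ j) ≡ lookup S j ∧ not (lookup t j)
  lookup-block-↑ʳ t S j =
    trans (lookup-++ʳ (S ∩ t) (S ∩ ∁ t) j)
          (trans (lookup-zipWith _∧_ j S (∁ t)) (cong (lookup S j ∧_) (lookup-map j not t)))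

  column-lift-↑ˡ : ∀ t a j → column (j ↑ˡ n) (lift t a) ≡ alternate (lookup t j) (column j a)
  column-lift-↑ˡ t []      j = refl
  column-lift-↑ˡ t (S ∷ a) j
    rewrite lookup-block-↑ˡ t S j
          | column-lift-↑ˡ (zipWith _xor_ S t) a j
          | lookup-zipWith _xor_ j S t
    with lookup S j
  ... | true  = refl
  ... | false = refl

  column-lift-↑ʳ : ∀ t a j →
                   column (n ↑ʳ j) (lift t a) ≡ alternate (not (lookup t j)) (column j a)
  column-lift-↑ʳ t []      j = refl
  column-lift-↑ʳ t (S ∷ a) j
    rewrite lookup-block-↑ʳ t S j
          | column-lift-↑ʳ (zipWith _xor_ S t) a j
          | lookup-zipWith _xor_ j S t
    with lookup S j
  ... | true  = refl
  ... | false = refl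

  length-lift : ∀ t a → length (lift t a) ≡ length a
  length-lift t []      = refl
  length-lift t (S ∷ a) = cong suc (length-lift (zipWith _xor_ S t) a)

  ψ-block : ∀ t S → ψ n (block t S) ≡ S
  ψ-block t S = trans (tabulate-cong lookup-ψ-block) (tabulate∘lookup S)
    where
    lookup-ψ-block : ∀ j → l∨r (left j) (right j) (block t S) ≡ lookup S j
    lookup-ψ-block j = trans (cong₂ _∨_ (lookup-block-↑ˡ t S j) (lookup-block-↑ʳ t S j))
                             (∧-∨-∧-not (lookup S j) (lookup t j))

  φ-lift : ∀ t a → φ n (lift t a) ≡ a
  φ-lift t []      = refl
  φ-lift t (S ∷ a) = cong₂ _∷_ (ψ-block t S) (φ-lift (zipWith _xor_ S t) a)

  block-nonempty : ∀ t {S} → Nonempty S → Nonempty (block t S)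
  block-nonempty t {S} (j , j∈S) with lookup t j in eq
  ... | true  = j ↑ˡ n , lookup⇒[]= _ _
                  (trans (lookup-block-↑ˡ t S j) (cong₂ _∧_ ([]=⇒lookup j∈S) eq))
  ... | false = n ↑ʳ j , lookup⇒[]= _ _
                  (trans (lookup-block-↑ʳ t S j) (cong₂ _∧_ ([]=⇒lookup j∈S) (cong not eq)))

  lift-nonempty : ∀ t {a} → All Nonempty a → All Nonempty (lift t a)
  lift-nonempty t All.[]          = All.[]
  lift-nonempty t (S≠∅ All.∷ a≠∅) = block-nonempty t S≠∅ All.∷ lift-nonempty _ a≠∅

  lift-E₁ : ∀ t a → E₁ n (lift t a)
  lift-E₁ t []      j = All.[]
  lift-E₁ t (S ∷ a) j = block-separates All.∷ lift-E₁ (zipWith _xor_ S t) a j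
    where
    block-separates : ¬ ((j ↑ˡ n) ∈ block t S × (n ↑ʳ j) ∈ block t S)
    block-separates (p , q) = ∧-not-exclusive (lookup S j) (lookup t j)
      ( trans (sym (lookup-block-↑ˡ t S j)) ([]=⇒lookup p)
      , trans (sym (lookup-block-↑ʳ t S j)) ([]=⇒lookup q) )

  lift-IsPartition : ∀ t a → ProperTwoCover n a → IsPartition (n + n) (lift t a)
  lift-IsPartition t a (nonempty , _ , twice) =
    trues-column≡1⇒IsPartition (lift t a) (lift-nonempty t nonempty)
      (↑ˡ-↑ʳ-elim once-left once-right)
    where
    once-left : ∀ j → trues (column (j ↑ˡ n) (lift t a)) ≡ 1
    once-left j = trans (cong trues (column-lift-↑ˡ t a j))
                        (trues-alternate-pair (lookup t j) (column j a) (trues-column-twice a twice j))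
    once-right : ∀ j → trues (column (n ↑ʳ j) (lift t a)) ≡ 1
    once-right j = trans (cong trues (column-lift-↑ʳ t a j))
                         (trues-alternate-pair (not (lookup t j)) (column j a)
                                               (trues-column-twice a twice j))

  lift-C : ∀ t a → ProperTwoCover n a → C n (lift t a)
  lift-C t a cover@(_ , unique , _) =
    lift-IsPartition t a cover , lift-E₁ t a , subst Unique (sym (φ-lift t a)) unique

  lift-injective : ∀ {t t′} a → (∀ d → multiplicity d a ≡ 2) → lift t a ≡ lift t′ a → t ≡ t′
  lift-injective {t} {t′} a twice eq = Pointwise-≡⇒≡ (ext λ j →
    alternate-injective (column j a) (subst (0 <_) (sym (trues-column-twice a twice j)) z<s)
      (begin
        alternate (lookup t j) (column j a)   ≡⟨ column-lift-↑ˡ t a j ⟨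
        column (j ↑ˡ n) (lift t a)            ≡⟨ cong (column (j ↑ˡ n)) eq ⟩
        column (j ↑ˡ n) (lift t′ a)           ≡⟨ column-lift-↑ˡ t′ a j ⟩
        alternate (lookup t′ j) (column j a)  ∎))
    where open ≡-Reasoning

  separating-partition⇒lift : ∀ ω → (∀ x → trues (column x ω) ≡ 1) → E₁ n ω →
                              ∃ λ t → ω ≡ lift t (φ n ω)
  separating-partition⇒lift ω once e₁ =
    t , columns-injective ω (lift t (φ n ω))
          (sym (trans (length-lift t (φ n ω)) (length-map (ψ n) ω)))
          (↑ˡ-↑ʳ-elim column-left column-right)
    where
    open ≡-Reasoning
    choice : ∀ j → ∃ λ b → Alternating (left j) (right j) b ω
    choice j = alternating (left j) (right j) ω (E₁⇒exclusive e₁ j) (once (j ↑ˡ n)) (once (n ↑ʳ j))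
    t : Subset n
    t = tabulate (proj₁ ∘ choice)
    column-left : ∀ j → column (j ↑ˡ n) ω ≡ column (j ↑ˡ n) (lift t (φ n ω))
    column-left j = begin
      column (j ↑ˡ n) ω
        ≡⟨ proj₁ (proj₂ (choice j)) ⟩
      alternate (proj₁ (choice j)) (map (l∨r (left j) (right j)) ω)
        ≡⟨ cong₂ alternate (lookup∘tabulate (proj₁ ∘ choice) j) (column-φ j ω) ⟨
      alternate (lookup t j) (column j (φ n ω))
        ≡⟨ column-lift-↑ˡ t (φ n ω) j ⟨
      column (j ↑ˡ n) (lift t (φ n ω)) ∎
    column-right : ∀ j → column (n ↑ʳ j) ω ≡ column (n ↑ʳ j) (lift t (φ n ω))
    column-right j = begin
      column (n ↑ʳ j) ω
        ≡⟨ proj₂ (proj₂ (choice j)) ⟩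
      alternate (not (proj₁ (choice j))) (map (l∨r (left j) (right j)) ω)
        ≡⟨ cong₂ alternate (cong not (lookup∘tabulate (proj₁ ∘ choice) j)) (column-φ j ω) ⟨
      alternate (not (lookup t j)) (column j (φ n ω))
        ≡⟨ column-lift-↑ʳ t (φ n ω) j ⟨
      column (n ↑ʳ j) (lift t (φ n ω)) ∎

  C-fibre⊆lifts : ∀ {a} ω → C n ω → φ n ω ↭ a → ∃ λ t → ω ↭ lift t a
  C-fibre⊆lifts ω ((_ , disjoint , covers) , e₁ , _) φω↭a
    with ω′ , refl , ω↭ω′ ← ↭-map-inv (ψ n) φω↭a
    with t , ω′≡lift ← separating-partition⇒lift ω′
           (λ x → trans (sym (trues-column-↭ x ω↭ω′))
                        (trues-column-partition x ω disjoint (covers x)))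
           (λ j → All-resp-↭ ω↭ω′ (e₁ j))
    = t , ↭-trans ω↭ω′ (↭-reflexive ω′≡lift)

module _ {n : ℕ} {a : List (Subset n)} (cover : ProperTwoCover n a) where

  lift-∈-fibre : ∀ t → C n (lift t a) × φ n (lift t a) ↭ a
  lift-∈-fibre t = lift-C t a cover , ↭-reflexive (φ-lift t a)

  lift-↭-injective : ∀ {t t′} → lift t a ↭ lift t′ a → t ≡ t′
  lift-↭-injective {t} {t′} lifts↭ =
    lift-injective a (proj₂ (proj₂ cover))
      (↭∧map≡⇒≡ (ψ n) (subst Unique (sym (φ-lift t a)) (proj₁ (proj₂ cover)))
                      (trans (φ-lift t a) (sym (φ-lift t′ a))) lifts↭)

lemma1 : (n : ℕ) → 1 ≤ n →
    ((ω : List (Subset (n + n))) → C n ω → ProperTwoCover n (φ n ω))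
    × ((a : List (Subset n)) → ProperTwoCover n a →
        (∃ λ ω → C n ω × φ n ω ↭ a)
        × (∃ λ (L : List (List (Subset (n + n)))) →
             length L ≡ 2 ^ n
             × All (λ ω → C n ω × φ n ω ↭ a) L
             × AllPairs (λ ω ω′ → ¬ (ω ↭ ω′)) L
             × ((ω : List (Subset (n + n))) → C n ω → φ n ω ↭ a → Any (ω ↭_) L)))
lemma1 n _ = φ-C⇒ProperTwoCover , λ a cover →
    (lift ∅ a , lift-∈-fibre cover ∅)
  , ( map (λ t → lift t a) (subsets n)
    , trans (length-map _ (subsets n)) (length-subsets n)
    , All.map⁺ (All.universal (lift-∈-fibre cover) (subsets n))
    , AllPairs.map⁺ (AllPairs.map (λ t≢t′ → t≢t′ ∘ lift-↭-injective cover) (subsets-unique n))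
    , λ ω Cω φω↭a → let t , ω↭lift = C-fibre⊆lifts ω Cω φω↭a in
        Any.map⁺ (Any.map (λ { refl → ω↭lift }) (∈-subsets t)) )
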